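{- Let $b,x_1,x_2$ be positive integers with $x_2\le x_1$ and $y_1,y_2$ nonnegative integers. In $L(b;x_1,y_1;x_2,y_2)$, for every $x\in\mathbb{N}$ with $(x \bmod (x_1+x_2))\in\{0,1,\ldots,x_1-1\}$ and every $y\in\mathbb{N}$, $\mathcal{SG}(x,y)\in\{0,1\}$ (i.e. such columns contain no $2$s or $3$s).
   Context: The Lengyel transfer game $L(b;x_1,y_1;x_2,y_2)$ is the impartial normal-play game on positions $(x,y)\in\mathbb{N}^2$ in which a move consists of adding one of $(0,-b)$, $(-x_1,y_1)$, $(-x_2,y_2)$, provided the result lies in $\mathbb{N}^2$; $\mathcal{SG}(x,y)$ is the Sprague–Grundy value (these values all lie in $\{0,1,2,3\}$). -}

module Defs where

open import Data.Nat using (ℕ; zero; suc; _+_; _∸_; _≤_; _<_; _≤?_; _≟_; s≤s; z≤n)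
open import Data.Nat.Properties using (m∸n≤m)
open import Data.Nat.Induction using (<-rec)
open import Data.Bool using (Bool; true; false; if_then_else_)
open import Data.Bool.ListAction using (any)
open import Data.List using (List; []; _∷_; length)
open import Relation.Nullary using (yes; no)
open import Relation.Nullary.Decidable using (⌊_⌋)

elem : ℕ → List ℕ → Bool
elem m l = any (λ a → ⌊ a ≟ m ⌋) l

-- mexFrom k n l : least m ≥ k with m ∉ l, searching at most n steps
-- (with k = 0 and n = length l the search always succeeds).
mexFrom : ℕ → ℕ → List ℕ → ℕ
mexFrom k zero    l = k
mexFrom k (suc n) l = if elem k l then mexFrom (suc k) n l else k

mex : List ℕ → ℕ
mex l = mexFrom 0 (length l) l

-- Grundy value of an option, if the corresponding move is legal
data Opt : Set where
  none : Opt
  some : ℕ → Opt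

collect : List Opt → List ℕ
collect []            = []
collect (none   ∷ os) = collect os
collect (some a ∷ os) = a ∷ collect os

sub-suc< : ∀ {d x} → suc d ≤ x → x ∸ suc d < x
sub-suc< {d} {suc x} (s≤s _) = s≤s (m∸n≤m x d)

-- Moves from (x,y):
--   (x, y ∸ b)       if y ≥ b,
--   (x ∸ x1, y + y1) if x ≥ x1,
--   (x ∸ x2, y + y2) if x ≥ x2. For positive b, x1, x2
-- every move decreases (x,y) lexicographically, so SG is defined by
-- well-founded recursion on x (outer) and y (inner). A zero step size
-- (excluded by the theorem's hypotheses) would give a non-terminating
-- game; it is simply treated as an absent move here.
module _ (b x1 y1 x2 y2 : ℕ) where

  xMove : (x : ℕ) → (∀ {x'} → x' < x → ℕ → ℕ) → ℕ → ℕ → Opt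
  xMove x rec zero    y' = none
  xMove x rec (suc d) y' with suc d ≤? x
  ... | yes p = some (rec {x ∸ suc d} (sub-suc< p) y')
  ... | no _  = none

  yMove : (y : ℕ) → (∀ {y'} → y' < y → ℕ) → Opt
  yMove y recy = step b
    where
      step : ℕ → Opt
      step zero = none
      step (suc c) with suc c ≤? y
      ... | yes p = some (recy {y ∸ suc c} (sub-suc< p))
      ... | no _  = none

  SG : ℕ → ℕ → ℕ
  SG = <-rec (λ _ → ℕ → ℕ) λ x rec →
    <-rec (λ _ → ℕ) λ y recy →
      mex (collect
        ( yMove y recy
        ∷ xMove x rec x1 (y + y1)
        ∷ xMove x rec x2 (y + y2)
        ∷ []))

{-# OPTIONS --safe #-}
-- Write G for the Sprague–Grundy function. Within a column, G(x, y + b) = G(x, y) xor 1: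
-- the options of (x, y + b) are (x, y) itself together with the transfer options of (x, y)
-- moved up by b, whose values are flipped by induction on x. So it suffices to bound G(x, y)
-- for y < b, where only transfers are legal. If x < x1, at most one transfer is legal and
-- G(x, y) ≤ 1. Otherwise x mod (x1 + x2) < x1 forces x ≥ x1 + x2, and both transfer options
-- of (x, y) can move to (x − x1 − x2, y + y1 + y2), a position in a column of the same kind.
-- Its value is therefore the value of no option of (x, y), so G(x, y) is at most that value,
-- which is at most 1 by induction on x.
module Submission where

open import Defs
open import Algebra.Properties.CommutativeSemigroup using (xy∙z≈xz∙y)
open import Data.Bool using (true; false)
open import Data.Empty using (⊥)
open import Data.List using (List; []; _∷_; length)
open import Data.List.Membership.Propositional using (_∈_; _∉_)
open import Data.List.Relation.Unary.Any using (Any; here; there)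
open import Data.Nat using (ℕ; zero; suc; _+_; _∸_; _≤_; _<_; _≤?_; _<?_; _≟_; _%_; z≤n; s≤s; z<s; NonZero; >-nonZero)
open import Data.Nat.DivMod using ([m+n]%n≡m%n; m<n⇒m%n≡m)
open import Data.Nat.Induction using (<-rec; <-wellFounded)
open import Data.Nat.Properties
open import Data.Product using (_×_; _,_; uncurry)
open import Data.Sum using (_⊎_; inj₁; inj₂)
open import Function using (_∘_; _⇔_; mk⇔; Equivalence)
open import Function.Construct.Composition using (_⇔-∘_)
open import Induction.WellFounded using (WellFounded; WfRec; Acc; acc; module Some)
open import Relation.Binary using (Rel; tri<; tri≈; tri>)
open import Relation.Binary.PropositionalEquality
open import Relation.Nullary using (¬_; yes; no; contradiction)
open import Relation.Unary using (Pred; _⊆′_)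

open Equivalence using (to; from)

record IsMex (P : ℕ → Set) (m : ℕ) : Set where
  field
    excluded : ¬ P m
    below    : ∀ {k} → k < m → P k

open IsMex

module _ {P : ℕ → Set} where

  IsMex-unique : ∀ {m n} → IsMex P m → IsMex P n → m ≡ n
  IsMex-unique {m} {n} M N with <-cmp m n
  ... | tri< m<n _ _ = contradiction (below N m<n) (excluded M)
  ... | tri≈ _ m≡n _ = m≡n
  ... | tri> _ _ n<m = contradiction (below M n<m) (excluded N)

  IsMex-resp : ∀ {Q : ℕ → Set} {m} → (∀ {k} → P k ⇔ Q k) → IsMex P m → IsMex Q m
  IsMex-resp P⇔Q M = record
    { excluded = excluded M ∘ from P⇔Q
    ; below    = to P⇔Q ∘ below M
    }

  IsMex-≤ : ∀ {m d} → IsMex P m → ¬ P d → m ≤ d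
  IsMex-≤ M ¬Pd = ≮⇒≥ (¬Pd ∘ below M)

  IsMex-≤1 : ∀ {m} → IsMex P m → ¬ (P 0 × P 1) → m ≤ 1
  IsMex-≤1 M ¬P01 = ≮⇒≥ λ 1<m → ¬P01 (below M (<-trans z<s 1<m) , below M 1<m)

count≥ : ℕ → List ℕ → ℕ
count≥ k []      = 0
count≥ k (a ∷ l) with k ≤? a
... | yes _ = suc (count≥ k l)
... | no  _ = count≥ k l

count≥-suc : ∀ k l → count≥ (suc k) l ≤ count≥ k l
count≥-suc k []      = z≤n
count≥-suc k (a ∷ l) with suc k ≤? a | k ≤? a
... | yes _   | yes _   = s≤s (count≥-suc k l)
... | yes k<a | no  k≰a = contradiction (<⇒≤ k<a) k≰a
... | no  _   | yes _   = m≤n⇒m≤1+n (count≥-suc k l)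
... | no  _   | no  _   = count≥-suc k l

count≥-∈ : ∀ {k l} → k ∈ l → count≥ (suc k) l < count≥ k l
count≥-∈ {k} {a ∷ l} (here refl) with suc k ≤? k | k ≤? k
... | yes k<k | _       = contradiction k<k (n≮n k)
... | no  _   | yes _   = s≤s (count≥-suc k l)
... | no  _   | no  k≰k = contradiction ≤-refl k≰k
count≥-∈ {k} {a ∷ l} (there k∈l) with suc k ≤? a | k ≤? a
... | yes _   | yes _   = s≤s (count≥-∈ k∈l)
... | yes k<a | no  k≰a = contradiction (<⇒≤ k<a) k≰a
... | no  _   | yes _   = m≤n⇒m≤1+n (count≥-∈ k∈l)
... | no  _   | no  _   = count≥-∈ k∈l

count≥-0 : ∀ l → count≥ 0 l ≤ length l
count≥-0 []      = z≤n
count≥-0 (a ∷ l) with 0 ≤? a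
... | yes _  = s≤s (count≥-0 l)
... | no 0≰a = contradiction z≤n 0≰a

elem⇒∈ : ∀ {k} l → elem k l ≡ true → k ∈ l
elem⇒∈ {k} (a ∷ l) e with a ≟ k
... | yes refl = here refl
... | no  _    = there (elem⇒∈ l e)

∈⇒elem : ∀ {k l} → k ∈ l → elem k l ≡ true
∈⇒elem {k} {a ∷ l} k∈ with a ≟ k | k∈
... | yes _   | _         = refl
... | no  a≢k | here k≡a  = contradiction (sym k≡a) a≢k
... | no  _   | there k∈l = ∈⇒elem k∈l

-- The number of entries ≥ k drops each time the search steps past a k ∈ l,
-- so a fuel of length l never runs out before an excluded value is found.
mexFrom-∉ : ∀ k n l → count≥ k l ≤ n → mexFrom k n l ∉ l
mexFrom-∉ k zero    l c k∈l = n≮0 (≤-trans (count≥-∈ k∈l) c)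
mexFrom-∉ k (suc n) l c with elem k l in eq
... | true  = mexFrom-∉ (suc k) n l (≤-pred (≤-trans (count≥-∈ (elem⇒∈ l eq)) c))
... | false = λ k∈l → contradiction (trans (sym eq) (∈⇒elem k∈l)) λ ()

mexFrom-below : ∀ k n l {j} → k ≤ j → j < mexFrom k n l → j ∈ l
mexFrom-below k zero    l k≤j j<k = contradiction (≤-trans j<k k≤j) (n≮n _)
mexFrom-below k (suc n) l k≤j j<m with elem k l in eq
... | false = contradiction (≤-trans j<m k≤j) (n≮n _)
... | true with m≤n⇒m<n∨m≡n k≤j
...   | inj₁ k<j  = mexFrom-below (suc k) n l k<j j<m
...   | inj₂ refl = elem⇒∈ l eq

mex-isMex : ∀ l → IsMex (_∈ l) (mex l)
mex-isMex l = record
  { excluded = mexFrom-∉ 0 (length l) l (count≥-0 l)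
  ; below    = mexFrom-below 0 (length l) l z≤n
  }

_∈ₒ_ : ℕ → Opt → Set
k ∈ₒ none   = ⊥
k ∈ₒ some a = k ≡ a

∈-collect : ∀ {k} os → k ∈ collect os ⇔ Any (k ∈ₒ_) os
∈-collect {k} os = mk⇔ (⁻ os) (⁺ os)
  where
  ⁻ : ∀ os → k ∈ collect os → Any (k ∈ₒ_) os
  ⁻ (none   ∷ os) k∈         = there (⁻ os k∈)
  ⁻ (some a ∷ os) (here k≡a) = here k≡a
  ⁻ (some a ∷ os) (there k∈) = there (⁻ os k∈)

  ⁺ : ∀ os → Any (k ∈ₒ_) os → k ∈ collect os
  ⁺ (none   ∷ os) (here ())
  ⁺ (none   ∷ os) (there k∈) = ⁺ os k∈
  ⁺ (some a ∷ os) (here k≡a) = here k≡a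
  ⁺ (some a ∷ os) (there k∈) = there (⁺ os k∈)

module _ {a r ℓ ℓ′} {A : Set a} {_<_ : Rel A r} {P : Pred A ℓ} (_≈_ : ∀ {x} → Rel (P x) ℓ′)
         {f g : WfRec _<_ P ⊆′ P}
         (f≈g : ∀ x {IH IH′ : WfRec _<_ P x} → (∀ {y} (y<x : y < x) → IH y<x ≈ IH′ y<x) → f x IH ≈ g x IH′) where

  wfRec-cong : ∀ {x} (q q′ : Acc _<_ x) → Some.wfRec P f x q ≈ Some.wfRec P g x q′
  wfRec-cong (acc rs) (acc rs′) = f≈g _ λ y<x → wfRec-cong (rs y<x) (rs′ y<x)

  wfRec-unfold : (wf : WellFounded _<_) → ∀ {x} (q : Acc _<_ x) →
                 Some.wfRec P f x q ≈ g x (λ {y} _ → Some.wfRec P g y (wf y))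
  wfRec-unfold wf (acc rs) = f≈g _ λ y<x → wfRec-cong (rs y<x) (wf _)

m%n<o≤m⇒n≤m : ∀ {m n o} .⦃ _ : NonZero n ⦄ → m % n < o → o ≤ m → n ≤ m
m%n<o≤m⇒n≤m {m} {n} m%n<o o≤m with m <? n
... | yes m<n = contradiction (≤-<-trans o≤m (subst (_< _) (m<n⇒m%n≡m m<n) m%n<o)) (n≮n _)
... | no  m≮n = ≮⇒≥ m≮n

[m∸n]%n≡m%n : ∀ {m n} .⦃ _ : NonZero n ⦄ → n ≤ m → (m ∸ n) % n ≡ m % n
[m∸n]%n≡m%n {m} {n} n≤m = trans (sym ([m+n]%n≡m%n (m ∸ n) n)) (cong (_% n) (m∸n+n≡m n≤m))

xor1 : ℕ → ℕ
xor1 0             = 1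
xor1 1             = 0
xor1 (suc (suc n)) = suc (suc (xor1 n))

xor1-involutive : ∀ n → xor1 (xor1 n) ≡ n
xor1-involutive 0             = refl
xor1-involutive 1             = refl
xor1-involutive (suc (suc n)) = cong (suc ∘ suc) (xor1-involutive n)

xor1-injective : ∀ {m n} → xor1 m ≡ xor1 n → m ≡ n
xor1-injective {m} {n} eq = begin
  m               ≡⟨ xor1-involutive m ⟨
  xor1 (xor1 m)   ≡⟨ cong xor1 eq ⟩
  xor1 (xor1 n)   ≡⟨ xor1-involutive n ⟩
  n               ∎
  where open ≡-Reasoning

xor1-≢ : ∀ n → xor1 n ≢ n
xor1-≢ 0             ()
xor1-≢ 1             ()
xor1-≢ (suc (suc n)) eq = xor1-≢ n (suc-injective (suc-injective eq))

xor1-< : ∀ {k n} → k < xor1 n → k ≢ n → xor1 k < n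
xor1-< {k}           {0}           (s≤s z≤n)       k≢n = contradiction refl k≢n
xor1-< {0}           {suc (suc n)} _               _   = s≤s (s≤s z≤n)
xor1-< {1}           {suc (suc n)} _               _   = s≤s z≤n
xor1-< {suc (suc k)} {suc (suc n)} (s≤s (s≤s k<n)) k≢n =
  s≤s (s≤s (xor1-< k<n (k≢n ∘ cong (suc ∘ suc))))

xor1-≤1 : ∀ {n} → n ≤ 1 → xor1 n ≤ 1
xor1-≤1 z≤n       = s≤s z≤n
xor1-≤1 (s≤s z≤n) = z≤n

module Moves (x1 y1 x2 y2 : ℕ) where

  yMove-cong : ∀ b y {r r′ : WfRec _<_ (λ _ → ℕ) y} → (∀ {y′} (p : y′ < y) → r p ≡ r′ p) →
               yMove b x1 y1 x2 y2 y r ≡ yMove b x1 y1 x2 y2 y r′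
  yMove-cong zero    y r≡r′ = refl
  yMove-cong (suc c) y r≡r′ with suc c ≤? y
  ... | yes p = cong some (r≡r′ (sub-suc< p))
  ... | no  _ = refl

  ∈ₒ-yMove : ∀ {b y k} (g : ℕ → ℕ) → 0 < b →
             k ∈ₒ yMove b x1 y1 x2 y2 y (λ {y′} _ → g y′) ⇔ (b ≤ y × k ≡ g (y ∸ b))
  ∈ₒ-yMove {suc c} {y} g _ with suc c ≤? y
  ... | yes b≤y = mk⇔ (b≤y ,_) (λ (_ , k≡) → k≡)
  ... | no  b≰y = mk⇔ (λ ()) (λ (b≤y , _) → contradiction b≤y b≰y)

  xMove-cong : ∀ b x {r r′ : WfRec _<_ (λ _ → ℕ → ℕ) x} → (∀ {x′} (p : x′ < x) → r p ≗ r′ p) →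
               ∀ d y′ → xMove b x1 y1 x2 y2 x r d y′ ≡ xMove b x1 y1 x2 y2 x r′ d y′
  xMove-cong b x r≗r′ zero    y′ = refl
  xMove-cong b x r≗r′ (suc d) y′ with suc d ≤? x
  ... | yes p = cong some (r≗r′ (sub-suc< p) y′)
  ... | no  _ = refl

  ∈ₒ-xMove : ∀ b {x d y′ k} (g : ℕ → ℕ → ℕ) → 0 < d →
             k ∈ₒ xMove b x1 y1 x2 y2 x (λ {x′} _ → g x′) d y′ ⇔ (d ≤ x × k ≡ g (x ∸ d) y′)
  ∈ₒ-xMove b {x} {suc d} g _ with suc d ≤? x
  ... | yes d≤x = mk⇔ (d≤x ,_) (λ (_ , k≡) → k≡)
  ... | no  d≰x = mk⇔ (λ ()) (λ (d≤x , _) → contradiction d≤x d≰x)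

-- Both this and sg below are opaque: letting the conversion checker unfold the
-- accessibility proofs driving the recursion in SG makes type checking intractably slow.
opaque
  <-wf : WellFounded _<_
  <-wf = <-wellFounded

module Lengyel (b x1 y1 x2 y2 : ℕ) where

  open Moves x1 y1 x2 y2

  opaque
    sg : ℕ → ℕ → ℕ
    sg = SG b x1 y1 x2 y2

  options : (x : ℕ) → WfRec _<_ (λ _ → ℕ → ℕ) x → (y : ℕ) → WfRec _<_ (λ _ → ℕ) y → List Opt
  options x r y r′ = yMove b x1 y1 x2 y2 y r′
                   ∷ xMove b x1 y1 x2 y2 x r x1 (y + y1)
                   ∷ xMove b x1 y1 x2 y2 x r x2 (y + y2)
                   ∷ []

  column : (x : ℕ) → WfRec _<_ (λ _ → ℕ → ℕ) x → ℕ → ℕ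
  column x r y = Some.wfRec (λ _ → ℕ) (λ y r′ → mex (collect (options x r y r′))) y (<-wf y)

  opaque
    unfolding sg <-wf
    sg-SG : ∀ x y → sg x y ≡ SG b x1 y1 x2 y2 x y
    sg-SG x y = refl

    sg-wfRec : ∀ x y → sg x y ≡ Some.wfRec (λ _ → ℕ → ℕ) column x (<-wf x) y
    sg-wfRec x y = refl

  options-cong : ∀ x {r r′ : WfRec _<_ (λ _ → ℕ → ℕ) x} → (∀ {x′} (p : x′ < x) → r p ≗ r′ p) →
                 ∀ y {s s′ : WfRec _<_ (λ _ → ℕ) y} → (∀ {y′} (p : y′ < y) → s p ≡ s′ p) →
                 mex (collect (options x r y s)) ≡ mex (collect (options x r′ y s′))
  options-cong x r≗r′ y s≡s′ = cong (mex ∘ collect) (cong₂ _∷_ (yMove-cong b y s≡s′)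
    (cong₂ _∷_ (xMove-cong b x r≗r′ x1 (y + y1)) (cong₂ _∷_ (xMove-cong b x r≗r′ x2 (y + y2)) refl)))

  column-cong : ∀ x {r r′ : WfRec _<_ (λ _ → ℕ → ℕ) x} → (∀ {x′} (p : x′ < x) → r p ≗ r′ p) →
                column x r ≗ column x r′
  column-cong x r≗r′ y = wfRec-cong _≡_ (options-cong x r≗r′) (<-wf y) (<-wf y)

  sg-unfold : ∀ x y → sg x y ≡ mex (collect (options x (λ {x′} _ → sg x′) y (λ {y′} _ → sg x y′)))
  sg-unfold x y = begin
    sg x y
      ≡⟨ sg-unfoldˣ y ⟩
    column x R y
      ≡⟨ wfRec-unfold _≡_ (options-cong x λ _ _ → refl) <-wf (<-wf y) ⟩
    mex (collect (options x R y (λ {y′} _ → column x R y′)))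
      ≡⟨ options-cong x (λ _ _ → refl) y (λ {y′} _ → sym (sg-unfoldˣ y′)) ⟩
    mex (collect (options x R y (λ {y′} _ → sg x y′))) ∎
    where
    open ≡-Reasoning
    R : WfRec _<_ (λ _ → ℕ → ℕ) x
    R {x′} _ = sg x′
    sg-unfoldˣ : sg x ≗ column x R
    sg-unfoldˣ y′ = begin
      sg x y′
        ≡⟨ sg-wfRec x y′ ⟩
      Some.wfRec (λ _ → ℕ → ℕ) column x (<-wf x) y′
        ≡⟨ wfRec-unfold (λ {_} → _≗_) column-cong <-wf (<-wf x) y′ ⟩
      column x (λ {x′} _ → Some.wfRec (λ _ → ℕ → ℕ) column x′ (<-wf x′)) y′
        ≡⟨ column-cong x (λ {x′} _ → sym ∘ sg-wfRec x′) y′ ⟩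
      column x R y′ ∎

  data Transfer : ℕ → ℕ → Set where
    first  : Transfer x1 y1
    second : Transfer x2 y2

  data Option (x y k : ℕ) : Set where
    down     : b ≤ y → k ≡ sg x (y ∸ b) → Option x y k
    transfer : ∀ {d e} → Transfer d e → d ≤ x → k ≡ sg (x ∸ d) (y + e) → Option x y k

  module _ (b>0 : 0 < b) (x1>0 : 0 < x1) (x2>0 : 0 < x2) where

    transfer-pos : ∀ {d e} → Transfer d e → 0 < d
    transfer-pos first  = x1>0
    transfer-pos second = x2>0

    options⇔Option : ∀ {x y k} →
                     Any (k ∈ₒ_) (options x (λ {x′} _ → sg x′) y (λ {y′} _ → sg x y′)) ⇔ Option x y k
    options⇔Option {x} {y} = mk⇔ ⇒ ⇐
      where
      ⇒ : ∀ {k} → Any (k ∈ₒ_) (options x (λ {x′} _ → sg x′) y (λ {y′} _ → sg x y′)) → Option x y k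
      ⇒ (here k∈)                 = uncurry down (to (∈ₒ-yMove (sg x) b>0) k∈)
      ⇒ (there (here k∈))         = uncurry (transfer first) (to (∈ₒ-xMove b sg x1>0) k∈)
      ⇒ (there (there (here k∈))) = uncurry (transfer second) (to (∈ₒ-xMove b sg x2>0) k∈)

      ⇐ : ∀ {k} → Option x y k → Any (k ∈ₒ_) (options x (λ {x′} _ → sg x′) y (λ {y′} _ → sg x y′))
      ⇐ (down b≤y k≡)              = here (from (∈ₒ-yMove (sg x) b>0) (b≤y , k≡))
      ⇐ (transfer first  d≤x k≡)   = there (here (from (∈ₒ-xMove b sg x1>0) (d≤x , k≡)))
      ⇐ (transfer second d≤x k≡)   = there (there (here (from (∈ₒ-xMove b sg x2>0) (d≤x , k≡))))

    sg-isMex : ∀ x y → IsMex (Option x y) (sg x y)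
    sg-isMex x y = subst (IsMex (Option x y)) (sym (sg-unfold x y))
      (IsMex-resp (options⇔Option ⇔-∘ ∈-collect _) (mex-isMex _))

    sg-≢-option : ∀ {x y k} → Option x y k → sg x y ≢ k
    sg-≢-option o refl = excluded (sg-isMex _ _) o

    transfer-shift : ∀ {x d e} → (∀ {x′} → x′ < x → ∀ y → sg x′ (y + b) ≡ xor1 (sg x′ y)) →
                     Transfer d e → d ≤ x → ∀ y → sg (x ∸ d) (y + b + e) ≡ xor1 (sg (x ∸ d) (y + e))
    transfer-shift ih t d≤x y =
      trans (cong (sg _) (xy∙z≈xz∙y +-commutativeSemigroup y b _)) (ih (∸-monoʳ-< (transfer-pos t) d≤x) _)

    sg-shift : ∀ x y → sg x (y + b) ≡ xor1 (sg x y)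
    sg-shift = <-rec (λ x → ∀ y → sg x (y + b) ≡ xor1 (sg x y)) λ x ihx →
               <-rec (λ y → sg x (y + b) ≡ xor1 (sg x y)) λ y ihy →
      IsMex-unique (sg-isMex x (y + b)) (shifted x ihx y ihy)
      where
      shifted : ∀ x → (∀ {x′} → x′ < x → ∀ y → sg x′ (y + b) ≡ xor1 (sg x′ y)) →
                ∀ y → (∀ {y′} → y′ < y → sg x (y′ + b) ≡ xor1 (sg x y′)) →
                IsMex (Option x (y + b)) (xor1 (sg x y))
      shifted x ihx y ihy = record { excluded = excl ; below = bel }
        where
        s = sg x y
        y+b∸b : sg x (y + b ∸ b) ≡ s
        y+b∸b = cong (sg x) (m+n∸n≡m y b)

        excl : ¬ Option x (y + b) (xor1 s)
        excl (down _ eq)        = xor1-≢ s (trans eq y+b∸b)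
        excl (transfer t d≤x eq) = excluded (sg-isMex x y)
          (transfer t d≤x (xor1-injective (trans eq (transfer-shift ihx t d≤x y))))

        bel : ∀ {k} → k < xor1 s → Option x (y + b) k
        bel {k} k<s′ with k ≟ s
        ... | yes k≡s = down (m≤n+m b y) (trans k≡s (sym y+b∸b))
        ... | no  k≢s with below (sg-isMex x y) (xor1-< k<s′ k≢s)
        ...   | transfer {d} {e} t d≤x eq = transfer t d≤x (begin
          k                         ≡⟨ xor1-involutive k ⟨
          xor1 (xor1 k)             ≡⟨ cong xor1 eq ⟩
          xor1 (sg (x ∸ d) (y + e)) ≡⟨ transfer-shift ihx t d≤x y ⟨
          sg (x ∸ d) (y + b + e)    ∎)
          where open ≡-Reasoning
        ...   | down b≤y eq = contradiction (begin
          k                        ≡⟨ xor1-involutive k ⟨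
          xor1 (xor1 k)            ≡⟨ cong xor1 eq ⟩
          xor1 (sg x (y ∸ b))      ≡⟨ ihy (∸-monoʳ-< b>0 b≤y) ⟨
          sg x (y ∸ b + b)         ≡⟨ cong (sg x) (m∸n+n≡m b≤y) ⟩
          s                        ∎) k≢s
          where open ≡-Reasoning

    transfer-after-transfer : ∀ {x y d e} → x1 + x2 ≤ x → Transfer d e →
                              Option (x ∸ d) (y + e) (sg (x ∸ (x1 + x2)) (y + y1 + y2))
    transfer-after-transfer {x} {y} n≤x first =
      transfer second (m+n≤o⇒m≤o∸n x2 (subst (_≤ x) (+-comm x1 x2) n≤x))
        (cong (λ z → sg z (y + y1 + y2)) (sym (∸-+-assoc x x1 x2)))
    transfer-after-transfer {x} {y} n≤x second =
      transfer first (m+n≤o⇒m≤o∸n x1 n≤x)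
        (cong₂ sg (trans (cong (x ∸_) (+-comm x1 x2)) (sym (∸-+-assoc x x2 x1)))
                  (xy∙z≈xz∙y +-commutativeSemigroup y y1 y2))

    sg-≤1-of-x<x1 : ∀ {x y} → y < b → x < x1 → sg x y ≤ 1
    sg-≤1-of-x<x1 {x} {y} y<b x<x1 =
      IsMex-≤1 (sg-isMex x y) λ (o₀ , o₁) → 0≢1+n (trans (only o₀) (sym (only o₁)))
      where
      only : ∀ {k} → Option x y k → k ≡ sg (x ∸ x2) (y + y2)
      only (down b≤y _)            = contradiction b≤y (<⇒≱ y<b)
      only (transfer first x1≤x _) = contradiction x1≤x (<⇒≱ x<x1)
      only (transfer second _ k≡)  = k≡

    sg-≤-double-transfer : ∀ {x y} → y < b → x1 + x2 ≤ x → sg x y ≤ sg (x ∸ (x1 + x2)) (y + y1 + y2)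
    sg-≤-double-transfer {x} {y} y<b n≤x = IsMex-≤ (sg-isMex x y) ¬option
      where
      ¬option : ¬ Option x y (sg (x ∸ (x1 + x2)) (y + y1 + y2))
      ¬option (down b≤y _)      = <⇒≱ y<b b≤y
      ¬option (transfer t _ eq) = sg-≢-option (transfer-after-transfer n≤x t) (sym eq)

    instance
      x1+x2-nonZero : NonZero (x1 + x2)
      x1+x2-nonZero = >-nonZero (<-≤-trans x1>0 (m≤m+n x1 x2))

    sg-≤1 : ∀ x → x % (x1 + x2) < x1 → ∀ y → sg x y ≤ 1
    sg-≤1 = <-rec (λ x → x % (x1 + x2) < x1 → ∀ y → sg x y ≤ 1) λ x ihx r<x1 →
            <-rec (λ y → sg x y ≤ 1) λ y ihy → column-≤1 ihx r<x1 ihy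
      where
      column-≤1 : ∀ {x y} → (∀ {x′} → x′ < x → x′ % (x1 + x2) < x1 → ∀ y → sg x′ y ≤ 1) →
                  x % (x1 + x2) < x1 → (∀ {y′} → y′ < y → sg x y′ ≤ 1) → sg x y ≤ 1
      column-≤1 {x} {y} ihx r<x1 ihy with b ≤? y | x1 ≤? x
      ... | yes b≤y | _ = subst (_≤ 1) (sym (begin
            sg x y              ≡⟨ cong (sg x) (m∸n+n≡m b≤y) ⟨
            sg x (y ∸ b + b)    ≡⟨ sg-shift x (y ∸ b) ⟩
            xor1 (sg x (y ∸ b)) ∎))
          (xor1-≤1 (ihy (∸-monoʳ-< b>0 b≤y)))
          where open ≡-Reasoning
      ... | no b≰y | no x1≰x  = sg-≤1-of-x<x1 (≰⇒> b≰y) (≰⇒> x1≰x)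
      ... | no b≰y | yes x1≤x = ≤-trans (sg-≤-double-transfer (≰⇒> b≰y) n≤x) (ihx x∸n<x r′<x1 _)
          where
          n≤x : x1 + x2 ≤ x
          n≤x = m%n<o≤m⇒n≤m r<x1 x1≤x
          x∸n<x : x ∸ (x1 + x2) < x
          x∸n<x = ∸-monoʳ-< (<-≤-trans x1>0 (m≤m+n x1 x2)) n≤x
          r′<x1 : (x ∸ (x1 + x2)) % (x1 + x2) < x1
          r′<x1 = subst (_< x1) (sym ([m∸n]%n≡m%n n≤x)) r<x1

mainTheorem17 : (b x1 y1 x2 y2 : ℕ) → 0 < b → (x1>0 : 0 < x1) → 0 < x2 → x2 ≤ x1 →
    (x y : ℕ) → (x % (x1 + x2)) ⦃ >-nonZero (<-≤-trans x1>0 (m≤m+n x1 x2)) ⦄ < x1 →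
    SG b x1 y1 x2 y2 x y ≡ 0 ⊎ SG b x1 y1 x2 y2 x y ≡ 1
mainTheorem17 b x1 y1 x2 y2 b>0 x1>0 x2>0 _ x y r<x1 =
  subst (λ v → v ≡ 0 ⊎ v ≡ 1) (sg-SG x y) (n≤1⇒n≡0∨n≡1 (sg-≤1 b>0 x1>0 x2>0 x r<x1 y))
  where open Lengyel b x1 y1 x2 y2
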